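{- Let $(G_i)_{i\in\mathbb{N}}$ be a sequence of games. Then: (1) If $G_i>0$ for every $i$, then $\sum^\bullet_{i\in\mathbb{N}} G_i\ge 1$. (2) If every partial sum $G_0+\dots+G_{h-1}$ is $<1$, then $\sum^\bullet_{i\in\mathbb{N}} G_i\le 1$. (3) If both hypotheses of (1) and (2) hold, then $\sum^\bullet_{i\in\mathbb{N}} G_i$ is Conway equivalent to $1$.
   Context: Games are combinatorial games in Conway's sense: possibly infinite, partizan, Left and Right, no draws, no infinite runs, normal play. A game is written $\{G^L\mid G^R\}$; $+$ is the disjunctive sum; $G$ and $H$ are Conway equivalent iff $G-H$ is a second-player win. $G\ge H$ means Left wins playing second on $G-H$; $G>H$ means Left wins on $G-H$ whoever starts; $\le$, $<$ symmetrically. $1=\{0\mid\}$. Partial sums are $G_0+\dots+G_{h-1}$. The sum $\sum^\bullet$. For a sequence $(H_i)_{i\in\mathbb{N}}$ and $n\in\mathbb{N}$, writing $H[i\mapsto K]$ for the sequence with $H_i$ replaced by $K$ and $H_0+\dots+H_j^L+\dots+H_m$ for the finite sum $H_0+\dots+H_m$ with $H_j$ replaced by a Left option of $H_j$, define (by transfinite induction on the natural sum of the birthdays of $H_0,\dots,H_n$) $(\sum^\bullet_i H_i)/R,n=\{\,(\sum^\bullet H[i\mapsto H_i^L])/R,n\ (i\le n),\ \ H_0+\dots+H_j^L+\dots+H_m\ (m\ge n,\ j\le m)\ \mid\ (\sum^\bullet H[i\mapsto H_i^R])/R,n\ (i\le n)\,\}$, $(\sum^\bullet_i H_i)/L,n=\{\,(\sum^\bullet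 H[i\mapsto H_i^L])/L,n\ (i\le n)\ \mid\ (\sum^\bullet H[i\mapsto H_i^R])/L,n\ (i\le n),\ \ H_0+\dots+H_j^R+\dots+H_m\ (m\ge n,\ j\le m)\,\}$, and $\sum^\bullet_{i\in\mathbb{N}} G_i=\{\,(\sum^\bullet G[i\mapsto G_i^L])/L,n\ (n\in\mathbb{N},\ i\le n)\mid(\sum^\bullet G[i\mapsto G_i^R])/R,n\ (n\in\mathbb{N},\ i\le n)\,\}$. Informally: the first player chooses $n$ and moves on some index $\le n$; thereafter both players move on indices $\le n$ until, at some turn of his, the second player chooses $m\ge n$ and moves on an index $\le m$; then play continues on the finite sum of the current positions of $G_0,\dots,G_m$. -}

module Defs where

open import Data.Nat using (ℕ; zero; suc; _+_)
open import Data.Fin using (Fin; toℕ)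
open import Data.Vec using (Vec; []; _∷_; tabulate; toList; _[_]≔_)
open import Data.List using (List; []; _∷_; _++_; applyUpTo)
open import Data.Product using (Σ; _×_; _,_)
open import Data.Sum using (_⊎_; inj₁; inj₂; [_,_])
open import Data.Empty using (⊥; ⊥-elim)
open import Data.Unit using (⊤; tt)

-- Conway games (possibly infinite, partizan).  A game is given by a
-- Set-indexed family of Left options and of Right options.  Games are
-- well-founded by construction (no infinite runs).

data Game : Set₁ where
  mk : (L R : Set) → (L → Game) → (R → Game) → Game

LeftIdx : Game → Set
LeftIdx (mk L R l r) = L

RightIdx : Game → Set
RightIdx (mk L R l r) = R

leftOpt : (g : Game) → LeftIdx g → Game
leftOpt (mk L R l r) = l

rightOpt : (g : Game) → RightIdx g → Game
rightOpt (mk L R l r) = r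

𝟘 : Game
𝟘 = mk ⊥ ⊥ ⊥-elim ⊥-elim

𝟙 : Game
𝟙 = mk ⊤ ⊥ (λ _ → 𝟘) ⊥-elim

⊝ : Game → Game
⊝ (mk L R l r) = mk R L (λ j → ⊝ (r j)) (λ i → ⊝ (l i))

infixl 6 _⊕_ _⊖_
_⊕_ : Game → Game → Game
G@(mk L R l r) ⊕ H@(mk L' R' l' r') =
  mk (L ⊎ L') (R ⊎ R')
     [ (λ i → l i ⊕ H) , (λ i → G ⊕ l' i) ]
     [ (λ j → r j ⊕ H) , (λ j → G ⊕ r' j) ]

_⊖_ : Game → Game → Game
G ⊖ H = G ⊕ (⊝ H)

sumList : List Game → Game
sumList []       = 𝟘
sumList (G ∷ Gs) = G ⊕ sumList Gs

partialSum : (ℕ → Game) → ℕ → Game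
partialSum G h = sumList (applyUpTo G h)

-- Outcomes (normal play: a player unable to move loses).

mutual
  LeftWinsSecond : Game → Set
  LeftWinsSecond (mk L R l r) = (j : R) → LeftWinsFirst (r j)

  LeftWinsFirst : Game → Set
  LeftWinsFirst (mk L R l r) = Σ L λ i → LeftWinsSecond (l i)

mutual
  RightWinsSecond : Game → Set
  RightWinsSecond (mk L R l r) = (i : L) → RightWinsFirst (l i)

  RightWinsFirst : Game → Set
  RightWinsFirst (mk L R l r) = Σ R λ j → RightWinsSecond (r j)

infix 4 _≥g_ _>g_ _≤g_ _<g_ _≈g_
_≥g_ : Game → Game → Set
G ≥g H = LeftWinsSecond (G ⊖ H)

_>g_ : Game → Game → Set
G >g H = LeftWinsSecond (G ⊖ H) × LeftWinsFirst (G ⊖ H)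

_≤g_ : Game → Game → Set
G ≤g H = RightWinsSecond (G ⊖ H)

_<g_ : Game → Game → Set
G <g H = RightWinsSecond (G ⊖ H) × RightWinsFirst (G ⊖ H)

_≈g_ : Game → Game → Set
G ≈g H = LeftWinsSecond (G ⊖ H) × RightWinsSecond (G ⊖ H)

-- For a tuple of games
-- ps = (P₀,…,P_{k-1}) and a decoration dec assigning to every tuple some
-- extra Left/Right options, Prod k dec ps is the game whose Left options
-- are  Prod k dec (ps with Pᵢ replaced by Pᵢᴸ)  (for every i < k) together
-- with the extra Left options of dec ps, and symmetrically for Right.
-- (Defined by recursion on k so that Agda sees termination.)

record Deco : Set₁ where
  field
    XL XR : Set
    xl : XL → Game
    xr : XR → Game
open Deco

mutual
  Prod : (k : ℕ) → (Vec Game k → Deco) → Vec Game k → Game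
  Prod zero    dec []       = mk (XL (dec [])) (XR (dec [])) (xl (dec [])) (xr (dec []))
  Prod (suc k) dec (G ∷ ps) = ProdS k dec G ps

  ProdS : (k : ℕ) → (Vec Game (suc k) → Deco) → Game → Vec Game k → Game
  ProdS k dec G@(mk L R l r) ps = Prod k ext ps
    where
    ext : Vec Game k → Deco
    ext qs = record
      { XL = XL (dec (G ∷ qs)) ⊎ L
      ; XR = XR (dec (G ∷ qs)) ⊎ R
      ; xl = [ xl (dec (G ∷ qs)) , (λ i → ProdS k dec (l i) qs) ]
      ; xr = [ xr (dec (G ∷ qs)) , (λ j → ProdS k dec (r j) qs) ]
      }

-- Current positions Hs = (H₀,…,H_n) of the first n+1 components; the
-- components of index > n are still the original G_{n+1}, G_{n+2}, ….
-- finSum n G Hs d = H₀ + … + H_n + G_{n+1} + … + G_{n+d}   (m = n + d ≥ n)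

finSum : (n : ℕ) → (ℕ → Game) → Vec Game (suc n) → ℕ → Game
finSum n G Hs d = sumList (toList Hs ++ applyUpTo (λ k → G (suc n + k)) d)

-- (∑• H)/R,n : extra Left options are  H₀+…+H_jᴸ+…+H_m  (m ≥ n, j ≤ m),
-- i.e. exactly the Left options of the finite sum H₀+…+H_m.
decR : (n : ℕ) → (ℕ → Game) → Vec Game (suc n) → Deco
decR n G Hs = record
  { XL = Σ ℕ λ d → LeftIdx (finSum n G Hs d)
  ; XR = ⊥
  ; xl = λ { (d , i) → leftOpt (finSum n G Hs d) i }
  ; xr = ⊥-elim }

-- (∑• H)/L,n : extra Right options are  H₀+…+H_jᴿ+…+H_m  (m ≥ n, j ≤ m).
decL : (n : ℕ) → (ℕ → Game) → Vec Game (suc n) → Deco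
decL n G Hs = record
  { XL = ⊥
  ; XR = Σ ℕ λ d → RightIdx (finSum n G Hs d)
  ; xl = ⊥-elim
  ; xr = λ { (d , j) → rightOpt (finSum n G Hs d) j } }

auxR auxL : (n : ℕ) → (ℕ → Game) → Vec Game (suc n) → Game
auxR n G Hs = Prod (suc n) (decR n G) Hs
auxL n G Hs = Prod (suc n) (decL n G) Hs

firstWith : (n : ℕ) → (ℕ → Game) → Fin (suc n) → Game → Vec Game (suc n)
firstWith n G i K = tabulate (λ k → G (toℕ k)) [ i ]≔ K

sumDot : (ℕ → Game) → Game
sumDot G = mk
  (Σ ℕ λ n → Σ (Fin (suc n)) λ i → LeftIdx (G (toℕ i)))
  (Σ ℕ λ n → Σ (Fin (suc n)) λ i → RightIdx (G (toℕ i)))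
  (λ { (n , i , a) → auxL n G (firstWith n G i (leftOpt (G (toℕ i)) a)) })
  (λ { (n , i , b) → auxR n G (firstWith n G i (rightOpt (G (toℕ i)) b)) })

-- (1) Playing second on ∑• G − 1, Left answers every Right move in a
-- component in that same component, using a second-player win of G_i > 0,
-- so all components stay positive.  When Right takes −1, Left chooses
-- m = n + 1 and moves first in the fresh component G_{n+1}, leaving a finite
-- sum of positive games.  If Right takes −1 at once, Left opens in G_0 with
-- n = 0; every finite sum Right may later close to then consists of positive
-- games, and Right has just moved in it.
-- (2) Left must open in some G_i with i ≤ n.  As G_0 + … + G_n < 1, Right
-- has a winning reply in (G_0 + … + G_i^L + … + G_n) − 1.  A reply in a
-- component he plays while choosing m = n; if the reply is the move on −1,
-- he copies his winning strategy on the finite sum H_0 + … + H_n inside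
-- (∑• H)/L,n, whose only Left moves are component moves.
module Submission where

open import Defs
open import Data.Nat using (ℕ; zero; suc; _+_)
open import Data.Fin using (Fin; zero; suc; toℕ)
open import Data.Vec using (Vec; []; _∷_; lookup; tabulate; toList; _[_]≔_)
open import Data.Vec.Properties using (lookup∘update; lookup∘tabulate; []≔-idempotent)
open import Data.Vec.Relation.Unary.All using (All; []; _∷_)
open import Data.Vec.Relation.Unary.All.Properties using (lookup⁺; tabulate⁺; toList⁺)
open import Data.List using (List; []; _∷_; _++_; applyUpTo)
open import Data.List.Properties using (++-identityʳ)
import Data.List.Relation.Unary.All as ListAll
open ListAll using ([]; _∷_)
open import Data.List.Relation.Unary.All.Properties using (++⁺; applyUpTo⁺₂)
open import Data.Product using (∃-syntax; _×_; _,_; proj₁; proj₂)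
open import Data.Sum using (_⊎_; inj₁; inj₂)
open import Data.Empty using (⊥; ⊥-elim)
open import Data.Unit using (tt)
open import Function using (_∘_)
open import Relation.Nullary using (¬_)
open import Relation.Binary.PropositionalEquality using (_≡_; refl; sym; cong; subst)
open Deco

private variable
  A B X Y g : Game
  k n d : ℕ
  i : Fin k
  ps : Vec Game k
  xs ys : List Game
  G : ℕ → Game
  dec : Vec Game k → Deco

infix 4 _∈ᴸ_ _∈ᴿ_

record _∈ᴸ_ (X g : Game) : Set₁ where
  constructor _,_
  field
    index  : LeftIdx g
    option : leftOpt g index ≡ X

record _∈ᴿ_ (X g : Game) : Set₁ where
  constructor _,_
  field
    index  : RightIdx g
    option : rightOpt g index ≡ X

leftWinsFirst-intro : X ∈ᴸ g → LeftWinsSecond X → LeftWinsFirst g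
leftWinsFirst-intro {g = mk _ _ _ _} (i , refl) w = i , w

leftWinsFirst-elim : LeftWinsFirst g → ∃[ X ] (X ∈ᴸ g × LeftWinsSecond X)
leftWinsFirst-elim {g = mk _ _ l _} (i , w) = l i , (i , refl) , w

leftWinsSecond-elim : LeftWinsSecond g → X ∈ᴿ g → LeftWinsFirst X
leftWinsSecond-elim {g = mk _ _ _ _} w (j , refl) = w j

rightWinsFirst-intro : X ∈ᴿ g → RightWinsSecond X → RightWinsFirst g
rightWinsFirst-intro {g = mk _ _ _ _} (j , refl) w = j , w

rightWinsFirst-elim : RightWinsFirst g → ∃[ X ] (X ∈ᴿ g × RightWinsSecond X)
rightWinsFirst-elim {g = mk _ _ _ r} (j , w) = r j , (j , refl) , w

rightWinsSecond-elim : RightWinsSecond g → X ∈ᴸ g → RightWinsFirst X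
rightWinsSecond-elim {g = mk _ _ _ _} w (i , refl) = w i

-- Strategies that maintain an invariant

LeftKeeps : (Game → Set₁) → Set₁
LeftKeeps P = ∀ {g X} → P g → X ∈ᴿ g → LeftWinsFirst X ⊎ ∃[ Y ] (Y ∈ᴸ X × P Y)

RightKeeps : (Game → Set₁) → Set₁
RightKeeps P = ∀ {g X} → P g → X ∈ᴸ g → RightWinsFirst X ⊎ ∃[ Y ] (Y ∈ᴿ X × P Y)

module _ {P : Game → Set₁} (keeps : LeftKeeps P) where
  mutual
    leftKeeps⇒leftWinsSecond : P g → LeftWinsSecond g
    leftKeeps⇒leftWinsSecond {g = mk _ _ _ r} p j =
      leftKeeps-reply {X = r j} (keeps p (j , refl))

    private
      leftKeeps-reply : LeftWinsFirst X ⊎ ∃[ Y ] (Y ∈ᴸ X × P Y) → LeftWinsFirst X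
      leftKeeps-reply (inj₁ w) = w
      leftKeeps-reply {X = mk _ _ l _} (inj₂ (_ , (i , refl) , p)) =
        i , leftKeeps⇒leftWinsSecond {g = l i} p

module _ {P : Game → Set₁} (keeps : RightKeeps P) where
  mutual
    rightKeeps⇒rightWinsSecond : P g → RightWinsSecond g
    rightKeeps⇒rightWinsSecond {g = mk _ _ l _} p i =
      rightKeeps-reply {X = l i} (keeps p (i , refl))

    private
      rightKeeps-reply : RightWinsFirst X ⊎ ∃[ Y ] (Y ∈ᴿ X × P Y) → RightWinsFirst X
      rightKeeps-reply (inj₁ w) = w
      rightKeeps-reply {X = mk _ _ _ r} (inj₂ (_ , (j , refl) , p)) =
        j , rightKeeps⇒rightWinsSecond {g = r j} p

⊕-leftOptˡ : X ∈ᴸ A → X ⊕ B ∈ᴸ A ⊕ B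
⊕-leftOptˡ {A = mk _ _ _ _} {B = mk _ _ _ _} (i , refl) = inj₁ i , refl

⊕-leftOptʳ : X ∈ᴸ B → A ⊕ X ∈ᴸ A ⊕ B
⊕-leftOptʳ {B = mk _ _ _ _} {A = mk _ _ _ _} (i , refl) = inj₂ i , refl

⊕-rightOptˡ : X ∈ᴿ A → X ⊕ B ∈ᴿ A ⊕ B
⊕-rightOptˡ {A = mk _ _ _ _} {B = mk _ _ _ _} (j , refl) = inj₁ j , refl

⊕-rightOptʳ : X ∈ᴿ B → A ⊕ X ∈ᴿ A ⊕ B
⊕-rightOptʳ {B = mk _ _ _ _} {A = mk _ _ _ _} (j , refl) = inj₂ j , refl

⊕-rightOptions : X ∈ᴿ A ⊕ B →
  ∃[ A′ ] (A′ ∈ᴿ A × X ≡ A′ ⊕ B) ⊎ ∃[ B′ ] (B′ ∈ᴿ B × X ≡ A ⊕ B′)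
⊕-rightOptions {A = mk _ _ _ r} {B = mk _ _ _ _} (inj₁ j , refl) = inj₁ (r j , (j , refl) , refl)
⊕-rightOptions {A = mk _ _ _ _} {B = mk _ _ _ r} (inj₂ j , refl) = inj₂ (r j , (j , refl) , refl)

mutual
  leftWinsSecond-⊕ : LeftWinsSecond A → LeftWinsSecond B → LeftWinsSecond (A ⊕ B)
  leftWinsSecond-⊕ {A =
    mk _ _ _ r} {B = mk _ _ _ _} a b (inj₁ j) = leftWinsFirst-⊕ˡ {A = r j} (a j) b
  leftWinsSecond-⊕ {A =
    mk _ _ _ _} {B = mk _ _ _ r} a b (inj₂ j) = leftWinsFirst-⊕ʳ {B = r j} a (b j)

  leftWinsFirst-⊕ˡ : LeftWinsFirst A → LeftWinsSecond B → LeftWinsFirst (A ⊕ B)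
  leftWinsFirst-⊕ˡ {A =
    mk _ _ l _} {B = mk _ _ _ _} (i , a) b = inj₁ i , leftWinsSecond-⊕ {A = l i} a b

  leftWinsFirst-⊕ʳ : LeftWinsSecond A → LeftWinsFirst B → LeftWinsFirst (A ⊕ B)
  leftWinsFirst-⊕ʳ {A =
    mk _ _ _ _} {B = mk _ _ l _} a (i , b) = inj₂ i , leftWinsSecond-⊕ {B = l i} a b

leftWinsSecond-sumList : ListAll.All LeftWinsSecond xs → LeftWinsSecond (sumList xs)
leftWinsSecond-sumList []       = λ ()
leftWinsSecond-sumList (w ∷ ws) = leftWinsSecond-⊕ w (leftWinsSecond-sumList ws)

leftWinsFirst-sumList : ListAll.All LeftWinsSecond xs → LeftWinsFirst Y →
  ListAll.All LeftWinsSecond ys → LeftWinsFirst (sumList (xs ++ Y ∷ ys))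
leftWinsFirst-sumList []       wY ws′ = leftWinsFirst-⊕ˡ wY (leftWinsSecond-sumList ws′)
leftWinsFirst-sumList (w ∷ ws) wY ws′ = leftWinsFirst-⊕ʳ w (leftWinsFirst-sumList ws wY ws′)

-- 𝟘 and ⊝ 𝟘 both have this form, with different vacuous option maps.
void : (⊥ → Game) → (⊥ → Game) → Game
void = mk ⊥ ⊥

module _ {l r : ⊥ → Game} where
  mutual
    leftWinsSecond-void⁻ : LeftWinsSecond (X ⊕ void l r) → LeftWinsSecond X
    leftWinsSecond-void⁻ {X = mk _ _ _ r′} w j = leftWinsFirst-void⁻ {X = r′ j} (w (inj₁ j))

    leftWinsFirst-void⁻ : LeftWinsFirst (X ⊕ void l r) → LeftWinsFirst X
    leftWinsFirst-void⁻ {X = mk _ _ l′ _} (inj₁ i , w) = i , leftWinsSecond-void⁻ {X = l′ i} w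
    leftWinsFirst-void⁻ {X = mk _ _ _ _}  (inj₂ () , _)

  mutual
    leftWinsSecond-void⁺ : LeftWinsSecond X → LeftWinsSecond (X ⊕ void l r)
    leftWinsSecond-void⁺ {X = mk _ _ _ r′} w (inj₁ j) = leftWinsFirst-void⁺ {X = r′ j} (w j)
    leftWinsSecond-void⁺ {X = mk _ _ _ _}  w (inj₂ ())

    leftWinsFirst-void⁺ : LeftWinsFirst X → LeftWinsFirst (X ⊕ void l r)
    leftWinsFirst-void⁺ {X = mk _ _ l′ _} (i , w) = inj₁ i , leftWinsSecond-void⁺ {X = l′ i} w

  mutual
    rightWinsSecond-void⁻ : RightWinsSecond (X ⊕ void l r) → RightWinsSecond X
    rightWinsSecond-void⁻ {X = mk _ _ l′ _} w i = rightWinsFirst-void⁻ {X = l′ i} (w (inj₁ i))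

    rightWinsFirst-void⁻ : RightWinsFirst (X ⊕ void l r) → RightWinsFirst X
    rightWinsFirst-void⁻ {X = mk _ _ _ r′} (inj₁ j , w) = j , rightWinsSecond-void⁻ {X = r′ j} w
    rightWinsFirst-void⁻ {X = mk _ _ _ _}  (inj₂ () , _)

  mutual
    rightWinsSecond-void⁺ : RightWinsSecond X → RightWinsSecond (X ⊕ void l r)
    rightWinsSecond-void⁺ {X = mk _ _ l′ _} w (inj₁ i) = rightWinsFirst-void⁺ {X = l′ i} (w i)
    rightWinsSecond-void⁺ {X = mk _ _ _ _}  w (inj₂ ())

    rightWinsFirst-void⁺ : RightWinsFirst X → RightWinsFirst (X ⊕ void l r)
    rightWinsFirst-void⁺ {X = mk _ _ _ r′} (j , w) = inj₁ j , rightWinsSecond-void⁺ {X = r′ j} w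

Prod-extraᴸ : (x : XL (dec ps)) → xl (dec ps) x ∈ᴸ Prod k dec ps
Prod-extraᴸ {ps = []}             x = x , refl
Prod-extraᴸ {ps = mk _ _ _ _ ∷ qs} x = Prod-extraᴸ {ps = qs} (inj₁ x)

Prod-extraᴿ : (x : XR (dec ps)) → xr (dec ps) x ∈ᴿ Prod k dec ps
Prod-extraᴿ {ps = []}             x = x , refl
Prod-extraᴿ {ps = mk _ _ _ _ ∷ qs} x = Prod-extraᴿ {ps = qs} (inj₁ x)

Prod-componentᴸ : ∀ i → Y ∈ᴸ lookup ps i → Prod k dec (ps [ i ]≔ Y) ∈ᴸ Prod k dec ps
Prod-componentᴸ {ps = mk _ _ _ _ ∷ qs} zero    (a , refl) = Prod-extraᴸ {ps = qs} (inj₂ a)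
Prod-componentᴸ {ps = mk _ _ _ _ ∷ qs} (suc i) Y∈         = Prod-componentᴸ {ps = qs} i Y∈

Prod-componentᴿ : ∀ i → Y ∈ᴿ lookup ps i → Prod k dec (ps [ i ]≔ Y) ∈ᴿ Prod k dec ps
Prod-componentᴿ {ps = mk _ _ _ _ ∷ qs} zero    (b , refl) = Prod-extraᴿ {ps = qs} (inj₂ b)
Prod-componentᴿ {ps = mk _ _ _ _ ∷ qs} (suc i) Y∈         = Prod-componentᴿ {ps = qs} i Y∈

Prod-leftOptions : X ∈ᴸ Prod k dec ps →
  ∃[ x ] X ≡ xl (dec ps) x ⊎ ∃[ i ] ∃[ Y ] (Y ∈ᴸ lookup ps i × X ≡ Prod k dec (ps [ i ]≔ Y))
Prod-leftOptions {ps = []} (x , refl) = inj₁ (x , refl)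
Prod-leftOptions {ps = mk _ _ l _ ∷ qs} X∈ with Prod-leftOptions {ps = qs} X∈
... | inj₁ (inj₁ x , e)  = inj₁ (x , e)
... | inj₁ (inj₂ a , e)  = inj₂ (zero , l a , (a , refl) , e)
... | inj₂ (i , Y∈)      = inj₂ (suc i , Y∈)

Prod-rightOptions : X ∈ᴿ Prod k dec ps →
  ∃[ x ] X ≡ xr (dec ps) x ⊎ ∃[ i ] ∃[ Y ] (Y ∈ᴿ lookup ps i × X ≡ Prod k dec (ps [ i ]≔ Y))
Prod-rightOptions {ps = []} (x , refl) = inj₁ (x , refl)
Prod-rightOptions {ps = mk _ _ _ r ∷ qs} X∈ with Prod-rightOptions {ps = qs} X∈
... | inj₁ (inj₁ x , e)  = inj₁ (x , e)
... | inj₁ (inj₂ b , e)  = inj₂ (zero , r b , (b , refl) , e)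
... | inj₂ (i , Y∈)      = inj₂ (suc i , Y∈)

vecSum : Vec Game k → Game
vecSum = sumList ∘ toList

vecSum-componentᴸ : ∀ i → Y ∈ᴸ lookup ps i → vecSum (ps [ i ]≔ Y) ∈ᴸ vecSum ps
vecSum-componentᴸ {ps = p ∷ qs} zero    Y∈ = ⊕-leftOptˡ {A = p} {B = vecSum qs} Y∈
vecSum-componentᴸ {ps = p ∷ qs} (suc i) Y∈ =
  ⊕-leftOptʳ {B = vecSum qs} {A = p} (vecSum-componentᴸ {ps = qs} i Y∈)

vecSum-rightOptions : X ∈ᴿ vecSum ps →
  ∃[ i ] ∃[ Y ] (Y ∈ᴿ lookup ps i × X ≡ vecSum (ps [ i ]≔ Y))
vecSum-rightOptions {ps = p ∷ qs} X∈ with ⊕-rightOptions {A = p} {B = vecSum qs} X∈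
... | inj₁ (Y , Y∈ , refl) = zero , Y , Y∈ , refl
... | inj₂ (_ , X′∈ , refl) with vecSum-rightOptions {ps = qs} X′∈
...   | i , Y , Y∈ , refl = suc i , Y , Y∈ , refl

All-[]≔ : ∀ {a p} {A : Set a} {P : A → Set p} {xs : Vec A k} {y} (i : Fin k) →
  All P xs → P y → All P (xs [ i ]≔ y)
All-[]≔ zero    (_ ∷ pxs)  py = py ∷ pxs
All-[]≔ (suc i) (px ∷ pxs) py = px ∷ All-[]≔ i pxs py

-- Left answers locally; Right copies a finite-sum strategy

module LeftAnswersLocally {k} (dec : Vec Game k → Deco) (B : Game)
  (answer-B : ∀ {qs B′} → All LeftWinsSecond qs → B′ ∈ᴿ B →
              LeftWinsFirst (Prod k dec qs ⊕ B′))
  (answer-extra : ∀ {qs} → All LeftWinsSecond qs → (x : XR (dec qs)) →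
                  LeftWinsFirst (xr (dec qs) x ⊕ B))
  where

  private
    Positive : Game → Set₁
    Positive g = ∃[ qs ] (g ≡ Prod k dec qs ⊕ B × All LeftWinsSecond qs)

    answer-component : All LeftWinsSecond ps → ∀ i → Y ∈ᴿ lookup ps i →
      ∃[ Z ] (Z ∈ᴸ Prod k dec (ps [ i ]≔ Y) ⊕ B × Positive Z)
    answer-component {ps = ps} {Y = Y} w i Y∈
      with leftWinsFirst-elim (leftWinsSecond-elim (lookup⁺ w i) Y∈)
    ... | Y′ , Y′∈ , w′ = _ , move , ps [ i ]≔ Y′ , forget-Y , All-[]≔ i w w′
      where
      move : Prod k dec ((ps [ i ]≔ Y) [ i ]≔ Y′) ⊕ B ∈ᴸ Prod k dec (ps [ i ]≔ Y) ⊕ B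
      move = ⊕-leftOptˡ (Prod-componentᴸ {ps = ps [ i ]≔ Y} i
                          (subst (Y′ ∈ᴸ_) (sym (lookup∘update i ps Y)) Y′∈))

      forget-Y : Prod k dec ((ps [ i ]≔ Y) [ i ]≔ Y′) ⊕ B ≡ Prod k dec (ps [ i ]≔ Y′) ⊕ B
      forget-Y = cong (λ qs → Prod k dec qs ⊕ B) ([]≔-idempotent ps i)

    keeps : LeftKeeps Positive
    keeps (qs , refl , w) X∈ with ⊕-rightOptions {A = Prod k dec qs} X∈
    ... | inj₂ (_ , B′∈ , refl) = inj₁ (answer-B w B′∈)
    ... | inj₁ (_ , P∈ , refl) with Prod-rightOptions {ps = qs} P∈
    ...   | inj₁ (x , refl)            = inj₁ (answer-extra w x)
    ...   | inj₂ (i , _ , Y∈ , refl)   = inj₂ (answer-component w i Y∈)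

  leftWinsSecond-Prod⊕ : All LeftWinsSecond ps → LeftWinsSecond (Prod k dec ps ⊕ B)
  leftWinsSecond-Prod⊕ w = leftKeeps⇒leftWinsSecond keeps (_ , refl , w)

  leftWinsFirst-Prod⊕ : All LeftWinsSecond ps → ∀ i → Y ∈ᴿ lookup ps i →
    LeftWinsFirst (Prod k dec (ps [ i ]≔ Y) ⊕ B)
  leftWinsFirst-Prod⊕ w i Y∈ with answer-component w i Y∈
  ... | _ , Z∈ , _ , refl , w′ = leftWinsFirst-intro Z∈ (leftWinsSecond-Prod⊕ w′)

module _ {k} {dec : Vec Game k → Deco} (no-extra-left : ∀ qs → ¬ XL (dec qs)) where

  private
    Copies : Game → Set₁
    Copies g = ∃[ qs ] (g ≡ Prod k dec qs × RightWinsSecond (vecSum qs))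

    keeps : RightKeeps Copies
    keeps (qs , refl , w) X∈ with Prod-leftOptions {ps = qs} X∈
    ... | inj₁ (x , _) = ⊥-elim (no-extra-left qs x)
    ... | inj₂ (i , Y , Y∈ , refl)
      with rightWinsFirst-elim (rightWinsSecond-elim w (vecSum-componentᴸ {ps = qs} i Y∈))
    ...   | _ , W∈ , w′ with vecSum-rightOptions {ps = qs [ i ]≔ Y} W∈
    ...     | i′ , _ , Y′∈ , refl =
      inj₂ (_ , Prod-componentᴿ {ps = qs [ i ]≔ Y} i′ Y′∈ , _ , refl , w′)

  rightWinsSecond-Prod : RightWinsSecond (vecSum ps) → RightWinsSecond (Prod k dec ps)
  rightWinsSecond-Prod w = rightKeeps⇒rightWinsSecond keeps (_ , refl , w)

firstTerms : (ℕ → Game) → (n : ℕ) → Vec Game (suc n)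
firstTerms G n = tabulate (G ∘ toℕ)

applyUpTo≡toList∘tabulate : ∀ {a} {A : Set a} (f : ℕ → A) m →
  applyUpTo f m ≡ toList (tabulate {n = m} (f ∘ toℕ))
applyUpTo≡toList∘tabulate f zero    = refl
applyUpTo≡toList∘tabulate f (suc m) = cong (f 0 ∷_) (applyUpTo≡toList∘tabulate (f ∘ suc) m)

partialSum-leftOpt : ∀ {i : Fin (suc n)} → X ∈ᴸ G (toℕ i) →
  vecSum (firstWith n G i X) ∈ᴸ partialSum G (suc n)
partialSum-leftOpt {n = n} {X = X} {G = G} {i = i} X∈ =
  subst (vecSum (firstWith n G i X) ∈ᴸ_) (cong sumList (sym (applyUpTo≡toList∘tabulate G (suc n))))
    (vecSum-componentᴸ {ps = firstTerms G n} i X∈lookup)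
  where
  X∈lookup : X ∈ᴸ lookup (firstTerms G n) i
  X∈lookup = subst (X ∈ᴸ_) (sym (lookup∘tabulate (G ∘ toℕ) i)) X∈

sumDot-leftOpt : ∀ {i : Fin (suc n)} → X ∈ᴸ G (toℕ i) →
  auxL n G (firstWith n G i X) ∈ᴸ sumDot G
sumDot-leftOpt {G = G} (a , refl) = (_ , _ , a) , refl

leftWinsFirst-auxR : ∀ {qs} → LeftWinsFirst (finSum n G qs d) → LeftWinsFirst (auxR n G qs)
leftWinsFirst-auxR {n = n} {G = G} {d = d} {qs} w with leftWinsFirst-elim w
... | _ , (ι , refl) , w′ =
  leftWinsFirst-intro (Prod-extraᴸ {dec = decR n G} {ps = qs} (d , ι)) w′

vecSum-rightOpt-auxL : ∀ {qs} → X ∈ᴿ vecSum qs → X ∈ᴿ auxL n G qs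
vecSum-rightOpt-auxL {n = n} {G = G} {qs = qs} X∈
  with subst (_ ∈ᴿ_) (cong sumList (sym (++-identityʳ (toList qs)))) X∈
... | j , refl = Prod-extraᴿ {dec = decL n G} {ps = qs} (0 , j)

sumDot-≥-𝟙 : (∀ i → G i >g 𝟘) → sumDot G ≥g 𝟙
sumDot-≥-𝟙 {G} positive = λ
  { (inj₁ (n , i , b)) → rightOpensInSum n i b
  ; (inj₂ tt)          → rightTakesOne }
  where
  second : ∀ m → LeftWinsSecond (G m)
  second m = leftWinsSecond-void⁻ (proj₁ (positive m))

  first : ∀ m → LeftWinsFirst (G m)
  first m = leftWinsFirst-void⁻ (proj₂ (positive m))

  allSecond : ∀ n → All LeftWinsSecond (firstTerms G n)
  allSecond n = tabulate⁺ (second ∘ toℕ)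

  rightOpensInSum : ∀ n i b →
    LeftWinsFirst (auxR n G (firstWith n G i (rightOpt (G (toℕ i)) b)) ⊕ ⊝ 𝟙)
  rightOpensInSum n i b = LeftAnswersLocally.leftWinsFirst-Prod⊕ (decR n G) (⊝ 𝟙)
    openFreshComponent (λ _ ()) (allSecond n) i Gᵢᴿ∈
    where
    openFreshComponent : ∀ {qs B′} → All LeftWinsSecond qs → B′ ∈ᴿ ⊝ 𝟙 →
      LeftWinsFirst (auxR n G qs ⊕ B′)
    openFreshComponent {qs} w (tt , refl) = leftWinsFirst-void⁺ {X = auxR n G qs}
      (leftWinsFirst-auxR {n = n} {G = G} {d = 1} {qs = qs}
        (leftWinsFirst-sumList (toList⁺ w) (first (suc n + 0)) []))

    Gᵢᴿ∈ : rightOpt (G (toℕ i)) b ∈ᴿ lookup (firstTerms G n) i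
    Gᵢᴿ∈ = subst (rightOpt (G (toℕ i)) b ∈ᴿ_) (sym (lookup∘tabulate (G ∘ toℕ) i))
             (b , refl)

  rightTakesOne : LeftWinsFirst (sumDot G ⊕ ⊝ 𝟘)
  rightTakesOne with leftWinsFirst-elim (first 0)
  ... | Y , Y∈ , w =
    leftWinsFirst-intro
      (⊕-leftOptˡ {B = ⊝ 𝟘} (sumDot-leftOpt {n = 0} {G = G} {i = zero} Y∈))
      (LeftAnswersLocally.leftWinsSecond-Prod⊕ (decL 0 G) (⊝ 𝟘)
        (λ _ ()) closeFiniteSum (All-[]≔ zero (allSecond 0) w))
    where
    closeFiniteSum : ∀ {qs} → All LeftWinsSecond qs → (x : XR (decL 0 G qs)) →
      LeftWinsFirst (xr (decL 0 G qs) x ⊕ ⊝ 𝟘)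
    closeFiniteSum {qs} w (d , j) = leftWinsFirst-void⁺ {X = rightOpt (finSum 0 G qs d) j}
      (leftWinsSecond-elim
        (leftWinsSecond-sumList (++⁺ (toList⁺ w) (applyUpTo⁺₂ _ d (second ∘ suc))))
        (j , refl))

sumDot-≤-𝟙 : (∀ h → partialSum G h <g 𝟙) → sumDot G ≤g 𝟙
sumDot-≤-𝟙 {G} below = λ
  { (inj₁ (n , i , a)) → leftOpensInSum n i a
  ; (inj₂ ()) }
  where
  leftOpensInSum : ∀ n i a →
    RightWinsFirst (auxL n G (firstWith n G i (leftOpt (G (toℕ i)) a)) ⊕ ⊝ 𝟙)
  leftOpensInSum n i a =
    reply (rightWinsFirst-elim (rightWinsSecond-elim (proj₁ (below (suc n))) Hs∈))
    where
    Hs = firstWith n G i (leftOpt (G (toℕ i)) a)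

    Hs∈ : vecSum Hs ⊕ ⊝ 𝟙 ∈ᴸ partialSum G (suc n) ⊕ ⊝ 𝟙
    Hs∈ = ⊕-leftOptˡ (partialSum-leftOpt {n = n} {G = G} {i = i} (a , refl))

    reply : ∃[ Z ] (Z ∈ᴿ vecSum Hs ⊕ ⊝ 𝟙 × RightWinsSecond Z) →
            RightWinsFirst (auxL n G Hs ⊕ ⊝ 𝟙)
    reply (_ , Z∈ , w) with ⊕-rightOptions {A = vecSum Hs} Z∈
    ... | inj₁ (_ , Z′∈ , refl) =
      rightWinsFirst-intro
        (⊕-rightOptˡ (vecSum-rightOpt-auxL {n = n} {G = G} {qs = Hs} Z′∈)) w
    ... | inj₂ (_ , (tt , refl) , refl) =
      rightWinsFirst-intro (⊕-rightOptʳ {A = auxL n G Hs} (tt , refl))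
        (rightWinsSecond-void⁺
          (rightWinsSecond-Prod {dec = decL n G} (λ _ ()) {ps = Hs} (rightWinsSecond-void⁻ w)))

proposition6p6 : (G : ℕ → Game) →
    (((i : ℕ) → G i >g 𝟘) → sumDot G ≥g 𝟙)
    × (((h : ℕ) → partialSum G h <g 𝟙) → sumDot G ≤g 𝟙)
    × (((i : ℕ) → G i >g 𝟘) → ((h : ℕ) → partialSum G h <g 𝟙) → sumDot G ≈g 𝟙)
proposition6p6 G =
  sumDot-≥-𝟙 , sumDot-≤-𝟙 , λ positive below → sumDot-≥-𝟙 positive , sumDot-≤-𝟙 below
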